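{- Every consistent infinite sequent $w_0$ can be extended to a maximal consistent infinite sequent $w$, i.e. one with $(w_0)_a\subseteq w_a$ and $(w_0)_s\subseteq w_s$.
   Context: Language: first-order language with predicate symbols, variables, constants (no other function symbols), $\&,\vee,\to,\bot,\forall,\exists$, and terms $\epsilon xA(x)$ for every formula $A(x)$. $t\downarrow$ is $\top$ for a variable or constant $t$, and $\exists y(\exists xA(x)\to A(y))$ for $t=\epsilon xA(x)$. IPC$\epsilon$: sequent calculus with axioms $\Gamma,A\Rightarrow A$, $\Gamma,\bot\Rightarrow A$, usual intuitionistic rules for $\&,\vee,\to$, $\Rightarrow\forall$ with eigenvariable condition, cut, and: from $\Gamma\Rightarrow t\downarrow$ and $F(t),\Delta\Rightarrow G$ infer $\forall zF(z),\Gamma,\Delta\Rightarrow G$; from $\Gamma\Rightarrow t\downarrow$ and $\Gamma\Rightarrow F(t)$ infer $\Gamma\Rightarrow\exists zF(z)$; from $A(\epsilon xA(x)),\Gamma\Rightarrow G$ infer $\exists xA(x),\Gamma\Rightarrow G$. An infinite sequent $w$ is a pair of sets of formulas $\Gamma,\Delta$ (written $\Gamma\Rightarrow\Delta$, with $w_a:=\Gamma$, $w_s:=\Delta$) such that infinitely many variables do not occur in $\Gamma\cup\Delta$. $L_w$ is the set of all terms and formulas whose free variables and constants occur in formulas of $w$. $w$ is consistent if no finite sequent $\Gamma\Rightarrow\Delta$ with $\Gamma\subseteq w_a$, $\Delta\subseteq w_s$ is derivable in (the multiple-succedent reading of) IPC$\epsilon$, i.e. $\Gamma\Rightarrow D_1\vee\dots\vee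 D_n$ is not derivable for $\Delta=\{D_1,\dots,D_n\}$ (empty disjunction $=\bot$). A consistent infinite sequent $w$ is maximal consistent if $w_a\cup w_s$ is the whole set of formulas of $L_w$. -}

module Defs where

open import Data.Nat using (ℕ; zero; suc; _≤_)
open import Data.Fin using (Fin; zero; suc)
open import Data.List using (List; []; _∷_; _++_)
open import Data.List.Membership.Propositional using (_∈_)
open import Data.List.Relation.Unary.All using (All)
open import Data.List.Relation.Unary.Any using (Any)
open import Data.List.Relation.Binary.Subset.Propositional using (_⊆_)
open import Data.Product using (Σ; _×_)
open import Data.Sum using (_⊎_)
open import Data.Empty using (⊥)
open import Relation.Nullary using (¬_)
open import Relation.Binary.PropositionalEquality using (_≡_)

-- Term n, Formula n : at most n bound variables in scope (de Bruijn,
-- index zero = innermost binder).  Free variables are named by ℕ,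
-- constants are named by ℕ, predicate symbols are named by ℕ
-- (a predicate symbol is a name together with the arity = length of
-- its argument list).  Formula 0 = the formulas of the language.

data Term (n : ℕ) : Set
data Formula (n : ℕ) : Set

data Term n where
  var : ℕ → Term n
  cst : ℕ → Term n
  bv  : Fin n → Term n
  eps : Formula (suc n) → Term n   -- ε x A(x); binds index zero of A

data Formula n where
  pred : ℕ → List (Term n) → Formula n
  _&_  : Formula n → Formula n → Formula n
  _∨_  : Formula n → Formula n → Formula n
  _⇒_  : Formula n → Formula n → Formula n
  ⊥f   : Formula n
  all  : Formula (suc n) → Formula n
  ex   : Formula (suc n) → Formula n

infixr 6 _&_
infixr 5 _∨_
infixr 4 _⇒_

liftR : ∀ {n m} → (Fin n → Fin m) → Fin (suc n) → Fin (suc m)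
liftR ρ zero    = zero
liftR ρ (suc i) = suc (ρ i)

renT  : ∀ {n m} → (Fin n → Fin m) → Term n → Term m
renTs : ∀ {n m} → (Fin n → Fin m) → List (Term n) → List (Term m)
renF  : ∀ {n m} → (Fin n → Fin m) → Formula n → Formula m

renT ρ (var x) = var x
renT ρ (cst c) = cst c
renT ρ (bv i)  = bv (ρ i)
renT ρ (eps A) = eps (renF (liftR ρ) A)

renTs ρ []       = []
renTs ρ (t ∷ ts) = renT ρ t ∷ renTs ρ ts

renF ρ (pred p ts) = pred p (renTs ρ ts)
renF ρ (A & B)     = renF ρ A & renF ρ B
renF ρ (A ∨ B)     = renF ρ A ∨ renF ρ B
renF ρ (A ⇒ B)     = renF ρ A ⇒ renF ρ B
renF ρ ⊥f          = ⊥f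
renF ρ (all A)     = all (renF (liftR ρ) A)
renF ρ (ex A)      = ex (renF (liftR ρ) A)

liftS : ∀ {n m} → (Fin n → Term m) → Fin (suc n) → Term (suc m)
liftS σ zero    = bv zero
liftS σ (suc i) = renT suc (σ i)

subT  : ∀ {n m} → (Fin n → Term m) → Term n → Term m
subTs : ∀ {n m} → (Fin n → Term m) → List (Term n) → List (Term m)
subF  : ∀ {n m} → (Fin n → Term m) → Formula n → Formula m

subT σ (var x) = var x
subT σ (cst c) = cst c
subT σ (bv i)  = σ i
subT σ (eps A) = eps (subF (liftS σ) A)

subTs σ []       = []
subTs σ (t ∷ ts) = subT σ t ∷ subTs σ ts

subF σ (pred p ts) = pred p (subTs σ ts)
subF σ (A & B)     = subF σ A & subF σ B
subF σ (A ∨ B)     = subF σ A ∨ subF σ B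
subF σ (A ⇒ B)     = subF σ A ⇒ subF σ B
subF σ ⊥f          = ⊥f
subF σ (all A)     = all (subF (liftS σ) A)
subF σ (ex A)      = ex (subF (liftS σ) A)

sub0 : ∀ {n} → Term n → Fin (suc n) → Term n
sub0 t zero    = t
sub0 t (suc i) = bv i

_[_] : ∀ {n} → Formula (suc n) → Term n → Formula n
A [ t ] = subF (sub0 t) A

wk : ∀ {n} → Formula n → Formula (suc n)
wk = renF suc

data Sym : Set where
  v : ℕ → Sym
  c : ℕ → Sym

occT  : ∀ {n} → Sym → Term n → Set
occTs : ∀ {n} → Sym → List (Term n) → Set
occF  : ∀ {n} → Sym → Formula n → Set

occT s (var x) = s ≡ v x
occT s (cst k) = s ≡ c k
occT s (bv i)  = ⊥
occT s (eps A) = occF s A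

occTs s []       = ⊥
occTs s (t ∷ ts) = occT s t ⊎ occTs s ts

occF s (pred p ts) = occTs s ts
occF s (A & B)     = occF s A ⊎ occF s B
occF s (A ∨ B)     = occF s A ⊎ occF s B
occF s (A ⇒ B)     = occF s A ⊎ occF s B
occF s ⊥f          = ⊥
occF s (all A)     = occF s A
occF s (ex A)      = occF s A

⊤f : Formula 0
⊤f = ⊥f ⇒ ⊥f

-- t↓ = ⊤ for variables and constants,
-- (ε x A(x))↓ = ∃ y (∃ x A(x) → A(y))
_↓ : Term 0 → Formula 0
var x ↓ = ⊤f
cst k ↓ = ⊤f
bv () ↓
eps A ↓ = ex (wk (ex A) ⇒ A)

-- Antecedents are finite sets, represented by lists; the rule `struct`
-- makes derivability depend only on the underlying set (exchange,
-- contraction; weakening is anyway built into the axioms).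

infix 2 _⊢_

data _⊢_ : List (Formula 0) → Formula 0 → Set where
  struct : ∀ {Γ Δ G} → Γ ⊆ Δ → Γ ⊢ G → Δ ⊢ G
  ax     : ∀ {Γ A} → A ∷ Γ ⊢ A
  ⊥L     : ∀ {Γ A} → ⊥f ∷ Γ ⊢ A
  &R     : ∀ {Γ A B} → Γ ⊢ A → Γ ⊢ B → Γ ⊢ A & B
  &L     : ∀ {Γ A B G} → A ∷ B ∷ Γ ⊢ G → (A & B) ∷ Γ ⊢ G
  ∨R₁    : ∀ {Γ A B} → Γ ⊢ A → Γ ⊢ A ∨ B
  ∨R₂    : ∀ {Γ A B} → Γ ⊢ B → Γ ⊢ A ∨ B
  ∨L     : ∀ {Γ A B G} → A ∷ Γ ⊢ G → B ∷ Γ ⊢ G → (A ∨ B) ∷ Γ ⊢ G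
  ⇒R     : ∀ {Γ A B} → A ∷ Γ ⊢ B → Γ ⊢ A ⇒ B
  ⇒L     : ∀ {Γ Δ A B G} → Γ ⊢ A → B ∷ Δ ⊢ G → (A ⇒ B) ∷ Γ ++ Δ ⊢ G
  ∀R     : ∀ {Γ F} (y : ℕ) → ¬ occF (v y) (all F) → ¬ Any (occF (v y)) Γ →
           Γ ⊢ F [ var y ] → Γ ⊢ all F
  ∀L     : ∀ {Γ Δ F G} (t : Term 0) → Γ ⊢ t ↓ → (F [ t ]) ∷ Δ ⊢ G →
           all F ∷ Γ ++ Δ ⊢ G
  ∃R     : ∀ {Γ F} (t : Term 0) → Γ ⊢ t ↓ → Γ ⊢ F [ t ] → Γ ⊢ ex F
  ∃L     : ∀ {Γ A G} → (A [ eps A ]) ∷ Γ ⊢ G → ex A ∷ Γ ⊢ G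
  cut    : ∀ {Γ Δ A G} → Γ ⊢ A → A ∷ Δ ⊢ G → Γ ++ Δ ⊢ G

⋁ : List (Formula 0) → Formula 0
⋁ []           = ⊥f
⋁ (D ∷ [])     = D
⋁ (D ∷ E ∷ Ds) = D ∨ ⋁ (E ∷ Ds)

record InfSequent : Set₁ where
  field
    ante : Formula 0 → Set
    succ : Formula 0 → Set
    -- infinitely many variables do not occur in w_a ∪ w_s
    fresh : ∀ (n : ℕ) → Σ ℕ λ x → n ≤ x ×
              (∀ (B : Formula 0) → ante B ⊎ succ B → ¬ occF (v x) B)
open InfSequent public

InL : InfSequent → Formula 0 → Set
InL w A = ∀ (s : Sym) → occF s A →
          Σ (Formula 0) λ B → (ante w B ⊎ succ w B) × occF s B

Consistent : InfSequent → Set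
Consistent w = ∀ (Γ Δ : List (Formula 0)) →
  All (ante w) Γ → All (succ w) Δ → ¬ (Γ ⊢ ⋁ Δ)

MaximalConsistent : InfSequent → Set
MaximalConsistent w =
  Consistent w × (∀ (A : Formula 0) → InL w A → ante w A ⊎ succ w A)

module Submission where

-- The proof is the classical Lindenbaum construction (it uses excluded
-- middle).  Formulas are enumerated by an injective code into ℕ; starting
-- from w₀, step n looks at the formula A with code n, if it lies in L_{w₀},
-- and puts it into the antecedent when this keeps the sequent consistent and
-- into the succedent otherwise.  The second choice is safe by a cut
-- argument: if both Γ, A ⇒ Δ and Γ ⇒ A, Δ were inconsistent, cutting on A
-- would make Γ ⇒ Δ inconsistent.  The union of the stages is consistent
-- because derivations use finitely many formulas, which all appear at some
-- finite stage; it decides every formula of L_{w₀}; and it only contains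
-- formulas of L_{w₀}, so the fresh variables of w₀ stay fresh.

open import Defs
open import Level using (0ℓ)
open import Axiom.ExcludedMiddle using (ExcludedMiddle)
open import Function using (_∘_; id)
open import Data.Product using (Σ; _×_; _,_; proj₁)
open import Relation.Unary using (_⊆_)
open import Data.Nat using (ℕ; zero; suc; _≤_; _⊔_; _≤′_; ≤′-refl; ≤′-step)
open import Data.Nat.Properties using (m≤m⊔n; m≤n⊔m; ≤⇒≤′)
import Data.Nat.Binary as Bin
import Data.Nat.Binary.Properties as Bin
open import Data.Fin using (Fin; toℕ)
open import Data.Maybe using (Maybe; just; nothing; map; zipWith)
open import Data.Maybe.Properties using (just-injective)
open import Data.List using (List; []; _∷_; _++_)
open import Data.List.Properties using (++-identityʳ)
import Data.List.Relation.Binary.Subset.Propositional as List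
open import Data.List.Relation.Binary.Subset.Propositional.Properties using (∷⁺ʳ; xs⊆x∷xs)
open import Data.List.Membership.Propositional using (_∈_)
open import Data.List.Membership.Propositional.Properties using (∈-++⁺ˡ; ∈-++⁺ʳ)
open import Data.List.Relation.Unary.Any using (here; there)
open import Data.List.Relation.Unary.All as All using (All; []; _∷_)
import Data.List.Relation.Unary.All.Properties as All
open import Data.Sum using (_⊎_; inj₁; inj₂)
open import Data.Empty using (⊥-elim)
open import Relation.Nullary using (¬_; yes; no)
open import Relation.Binary.PropositionalEquality using (_≡_; refl; sym; cong; cong₂; subst; module ≡-Reasoning)

data Tree : Set where
  leaf : ℕ → Tree
  node : Tree → Tree → Tree

-- Prefix serialisation of a tree into binary numerals, continuing with r:
-- a leaf k is a 1-digit followed by k 2-digits and a 1-digit.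
unary : ℕ → Bin.ℕᵇ → Bin.ℕᵇ
unary zero    r = Bin.1+[2 r ]
unary (suc k) r = Bin.2[1+ unary k r ]

serialise : Tree → Bin.ℕᵇ → Bin.ℕᵇ
serialise (leaf k)   r = Bin.1+[2 unary k r ]
serialise (node s t) r = Bin.2[1+ serialise s (serialise t r) ]

unary-injective : ∀ j k {r r′} → unary j r ≡ unary k r′ → j ≡ k × r ≡ r′
unary-injective zero    zero    eq = refl , Bin.1+[2_]-injective eq
unary-injective zero    (suc k) ()
unary-injective (suc j) zero    ()
unary-injective (suc j) (suc k) eq with unary-injective j k (Bin.2[1+_]-injective eq)
... | refl , r≡r′ = refl , r≡r′

serialise-injective : ∀ s t {r r′} → serialise s r ≡ serialise t r′ → s ≡ t × r ≡ r′
serialise-injective (leaf j) (leaf k) eq with unary-injective j k (Bin.1+[2_]-injective eq)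
... | refl , r≡r′ = refl , r≡r′
serialise-injective (leaf j) (node t u) ()
serialise-injective (node s u) (leaf k) ()
serialise-injective (node s s′) (node t t′) eq with serialise-injective s t (Bin.2[1+_]-injective eq)
... | refl , eq′ with serialise-injective s′ t′ eq′
... | refl , r≡r′ = refl , r≡r′

treeT  : ∀ {n} → Term n → Tree
treeTs : ∀ {n} → List (Term n) → Tree
treeF  : ∀ {n} → Formula n → Tree

treeT (var x) = node (leaf 0) (leaf x)
treeT (cst k) = node (leaf 1) (leaf k)
treeT (bv i)  = node (leaf 2) (leaf (toℕ i))
treeT (eps A) = node (leaf 3) (treeF A)

treeTs []       = leaf 0
treeTs (t ∷ ts) = node (treeT t) (treeTs ts)

treeF (pred p ts) = node (leaf 0) (node (leaf p) (treeTs ts))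
treeF (A & B)     = node (leaf 1) (node (treeF A) (treeF B))
treeF (A ∨ B)     = node (leaf 2) (node (treeF A) (treeF B))
treeF (A ⇒ B)     = node (leaf 3) (node (treeF A) (treeF B))
treeF ⊥f          = leaf 0
treeF (all A)     = node (leaf 4) (treeF A)
treeF (ex A)      = node (leaf 5) (treeF A)

-- Reading back a tree; it is a left inverse of the tree encoding, which
-- gives injectivity without comparing distinct constructors pairwise.
toFin : ∀ n → ℕ → Maybe (Fin n)
toFin zero    _       = nothing
toFin (suc n) zero    = just Fin.zero
toFin (suc n) (suc i) = map Fin.suc (toFin n i)

readT  : ∀ {n} → Tree → Maybe (Term n)
readTs : ∀ {n} → Tree → Maybe (List (Term n))
readF  : ∀ {n} → Tree → Maybe (Formula n)

readT (node (leaf 0) (leaf x)) = just (var x)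
readT (node (leaf 1) (leaf k)) = just (cst k)
readT (node (leaf 2) (leaf i)) = map bv (toFin _ i)
readT (node (leaf 3) a)        = map eps (readF a)
readT _                        = nothing

readTs (leaf _)   = just []
readTs (node a b) = zipWith _∷_ (readT a) (readTs b)

readF (node (leaf 0) (node (leaf p) a)) = map (pred p) (readTs a)
readF (node (leaf 1) (node a b))        = zipWith _&_ (readF a) (readF b)
readF (node (leaf 2) (node a b))        = zipWith _∨_ (readF a) (readF b)
readF (node (leaf 3) (node a b))        = zipWith _⇒_ (readF a) (readF b)
readF (leaf 0)                          = just ⊥f
readF (node (leaf 4) a)                 = map all (readF a)
readF (node (leaf 5) a)                 = map ex (readF a)
readF _                                 = nothing

toFin-toℕ : ∀ {n} (i : Fin n) → toFin n (toℕ i) ≡ just i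
toFin-toℕ Fin.zero    = refl
toFin-toℕ (Fin.suc i) = cong (map Fin.suc) (toFin-toℕ i)

readT-treeT   : ∀ {n} (t : Term n) → readT (treeT t) ≡ just t
readTs-treeTs : ∀ {n} (ts : List (Term n)) → readTs (treeTs ts) ≡ just ts
readF-treeF   : ∀ {n} (A : Formula n) → readF (treeF A) ≡ just A

readT-treeT (var x) = refl
readT-treeT (cst k) = refl
readT-treeT (bv i)  = cong (map bv) (toFin-toℕ i)
readT-treeT (eps A) = cong (map eps) (readF-treeF A)

readTs-treeTs []       = refl
readTs-treeTs (t ∷ ts) = cong₂ (zipWith _∷_) (readT-treeT t) (readTs-treeTs ts)

readF-treeF (pred p ts) = cong (map (pred p)) (readTs-treeTs ts)
readF-treeF (A & B)     = cong₂ (zipWith _&_) (readF-treeF A) (readF-treeF B)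
readF-treeF (A ∨ B)     = cong₂ (zipWith _∨_) (readF-treeF A) (readF-treeF B)
readF-treeF (A ⇒ B)     = cong₂ (zipWith _⇒_) (readF-treeF A) (readF-treeF B)
readF-treeF ⊥f          = refl
readF-treeF (all A)     = cong (map all) (readF-treeF A)
readF-treeF (ex A)      = cong (map ex) (readF-treeF A)

code : Formula 0 → ℕ
code A = Bin.toℕ (serialise (treeF A) Bin.zero)

code-injective : ∀ A B → code A ≡ code B → A ≡ B
code-injective A B eq = just-injective (begin
    just A               ≡⟨ sym (readF-treeF A) ⟩
    readF (treeF A)      ≡⟨ cong readF trees-equal ⟩
    readF (treeF B)      ≡⟨ readF-treeF B ⟩
    just B               ∎)
  where
  open ≡-Reasoning
  trees-equal : treeF A ≡ treeF B
  trees-equal = proj₁ (serialise-injective (treeF A) (treeF B) (Bin.toℕ-injective eq))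

private variable
  Γ Γ′ Δ Δ′ : List (Formula 0)
  A G : Formula 0

⋁-intro : A ∈ Δ → A ∷ Γ ⊢ ⋁ Δ
⋁-intro {Δ = _ ∷ []}    (here refl) = ax
⋁-intro {Δ = _ ∷ _ ∷ _} (here refl) = ∨R₁ ax
⋁-intro {Δ = _ ∷ _ ∷ _} (there A∈) = ∨R₂ (⋁-intro A∈)

⋁-cases : A ∷ Γ ⊢ G → ⋁ Δ ∷ Γ ⊢ G → ⋁ (A ∷ Δ) ∷ Γ ⊢ G
⋁-cases {Δ = []}    left right = left
⋁-cases {Δ = _ ∷ _} left right = ∨L left right

⋁-⊆ : Δ List.⊆ Δ′ → ⋁ Δ ∷ Γ ⊢ ⋁ Δ′
⋁-⊆ {Δ = []}        Δ⊆ = ⊥L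
⋁-⊆ {Δ = _ ∷ []}    Δ⊆ = ⋁-intro (Δ⊆ (here refl))
⋁-⊆ {Δ = _ ∷ _ ∷ _} Δ⊆ = ∨L (⋁-intro (Δ⊆ (here refl))) (⋁-⊆ (Δ⊆ ∘ there))

weaken⋁ : Δ List.⊆ Δ′ → Γ ⊢ ⋁ Δ → Γ ⊢ ⋁ Δ′
weaken⋁ {Γ = Γ} Δ⊆ d = subst (_⊢ _) (++-identityʳ Γ) (cut d (⋁-⊆ {Γ = []} Δ⊆))

cut⋁ : Γ ⊢ ⋁ (A ∷ Δ) → A ∷ Γ′ ⊢ ⋁ Δ′ → Γ ++ Γ′ ⊢ ⋁ (Δ′ ++ Δ)
cut⋁ {Δ = Δ} {Δ′ = Δ′} d e =
  cut d (⋁-cases {Δ = Δ} (weaken⋁ {Δ = Δ′} ∈-++⁺ˡ e) (weaken⋁ {Δ = Δ} (∈-++⁺ʳ Δ′) ax))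

Pred : Set₁
Pred = Formula 0 → Set

Cons : Pred → Pred → Set
Cons a s = ∀ (Γ Δ : List (Formula 0)) → All a Γ → All s Δ → ¬ (Γ ⊢ ⋁ Δ)

_⊕_ : Pred → Formula 0 → Pred
(a ⊕ A) B = a B ⊎ B ≡ A

separate : ∀ {a} → All (a ⊕ A) Γ → Σ (List (Formula 0)) λ Γ′ → All a Γ′ × Γ List.⊆ A ∷ Γ′
separate [] = [] , [] , λ ()
separate {A = A} {Γ = B ∷ _} (inj₁ aB ∷ rest) =
  let Γ′ , aΓ′ , covered = separate rest
  in B ∷ Γ′ , aB ∷ aΓ′ , λ { (here refl) → there (here refl)
                           ; (there C∈) → ∷⁺ʳ A (xs⊆x∷xs Γ′ B) (covered C∈) }
separate (inj₂ refl ∷ rest) =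
  let Γ′ , aΓ′ , covered = separate rest
  in Γ′ , aΓ′ , λ { (here refl) → here refl ; (there C∈) → covered C∈ }

cons-right : ∀ {a s} → Cons a s → ¬ Cons (a ⊕ A) s → Cons a (s ⊕ A)
cons-right consistent left-inconsistent Γ Δ aΓ sΔ d = left-inconsistent λ Γ₁ Δ₁ aΓ₁ sΔ₁ d₁ →
  let Γ₁′ , aΓ₁′ , Γ₁⊆ = separate aΓ₁
      Δ′  , sΔ′  , Δ⊆  = separate sΔ
  in consistent (Γ ++ Γ₁′) (Δ₁ ++ Δ′) (All.++⁺ aΓ aΓ₁′) (All.++⁺ sΔ₁ sΔ′)
       (cut⋁ {Δ = Δ′} {Δ′ = Δ₁} (weaken⋁ Δ⊆ d) (struct Γ₁⊆ d₁))

module _ {X : Set} where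

  Grows : (ℕ → X → Set) → Set
  Grows P = ∀ n → P n ⊆ P (suc n)

  Union : (ℕ → X → Set) → X → Set
  Union P x = Σ ℕ λ n → P n x

  grows-mono : ∀ {P} → Grows P → ∀ {m n} → m ≤ n → P m ⊆ P n
  grows-mono {P} grows = along ∘ ≤⇒≤′
    where
    along : ∀ {m n} → m ≤′ n → P m ⊆ P n
    along ≤′-refl        = id
    along (≤′-step m≤n) = grows _ ∘ along m≤n

  finite-bound : ∀ {P xs} → Grows P → All (Union P) xs → Σ ℕ λ N → All (P N) xs
  finite-bound grows [] = 0 , []
  finite-bound grows ((n , x∈) ∷ rest) =
    let N , rest∈ = finite-bound grows rest
    in n ⊔ N , grows-mono grows (m≤m⊔n n N) x∈ ∷ All.map (grows-mono grows (m≤n⊔m n N)) rest∈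

-- The union of an increasing chain of consistent sequents is consistent,
-- since a derivation uses only finitely many formulas.
union-consistent : ∀ {a s : ℕ → Pred} → Grows a → Grows s → (∀ n → Cons (a n) (s n)) →
                   Cons (Union a) (Union s)
union-consistent a-grows s-grows consistent Γ Δ aΓ sΔ d =
  let N₁ , aΓ′ = finite-bound a-grows aΓ
      N₂ , sΔ′ = finite-bound s-grows sΔ
  in consistent (N₁ ⊔ N₂) Γ Δ (All.map (grows-mono a-grows (m≤m⊔n N₁ N₂)) aΓ′)
                              (All.map (grows-mono s-grows (m≤n⊔m N₁ N₂)) sΔ′) d

record Completion (L a₀ s₀ : Pred) : Set₁ where
  field
    ants sucs  : Pred
    consistent : Cons ants sucs
    ants-⊇     : a₀ ⊆ ants
    sucs-⊇     : s₀ ⊆ sucs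
    decides    : ∀ A → L A → ants A ⊎ sucs A
    within     : ∀ B → ants B ⊎ sucs B → L B

record PreSequent : Set₁ where
  constructor _⇛_
  field lhs rhs : Pred
open PreSequent

Mem : PreSequent → Pred
Mem p B = lhs p B ⊎ rhs p B

module Lindenbaum (em : ExcludedMiddle 0ℓ) (L : Pred) where

  -- The formula of L with code n, if there is one; code-injective makes it unique.
  target : ℕ → Maybe (Formula 0)
  target n with em {Σ (Formula 0) λ A → code A ≡ n × L A}
  ... | yes (A , _) = just A
  ... | no _        = nothing

  target-code : ∀ {A} → L A → target (code A) ≡ just A
  target-code {A} LA with em {Σ (Formula 0) λ B → code B ≡ code A × L B}
  ... | yes (B , same-code , _) = cong just (code-injective B A same-code)
  ... | no none                 = ⊥-elim (none (A , refl , LA))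

  target-in-L : ∀ {n A} → target n ≡ just A → L A
  target-in-L {n} eq with em {Σ (Formula 0) λ A → code A ≡ n × L A}
  target-in-L refl | yes (_ , _ , LA) = LA
  target-in-L ()   | no _

  insert : PreSequent → Maybe (Formula 0) → PreSequent
  insert p nothing = p
  insert (a ⇛ s) (just A) with em {Cons (a ⊕ A) s}
  ... | yes _ = (a ⊕ A) ⇛ s
  ... | no _  = a ⇛ (s ⊕ A)

  insert-consistent : ∀ p m → Cons (lhs p) (rhs p) → Cons (lhs (insert p m)) (rhs (insert p m))
  insert-consistent p nothing consistent = consistent
  insert-consistent (a ⇛ s) (just A) consistent with em {Cons (a ⊕ A) s}
  ... | yes left-consistent  = left-consistent
  ... | no left-inconsistent = cons-right consistent left-inconsistent

  insert-grows-lhs : ∀ p m → lhs p ⊆ lhs (insert p m)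
  insert-grows-lhs p nothing = id
  insert-grows-lhs (a ⇛ s) (just A) with em {Cons (a ⊕ A) s}
  ... | yes _ = inj₁
  ... | no _  = id

  insert-grows-rhs : ∀ p m → rhs p ⊆ rhs (insert p m)
  insert-grows-rhs p nothing = id
  insert-grows-rhs (a ⇛ s) (just A) with em {Cons (a ⊕ A) s}
  ... | yes _ = id
  ... | no _  = inj₁

  insert-places : ∀ p A → Mem (insert p (just A)) A
  insert-places (a ⇛ s) A with em {Cons (a ⊕ A) s}
  ... | yes _ = inj₁ (inj₂ refl)
  ... | no _  = inj₂ (inj₂ refl)

  insert-new : ∀ p m {B} → Mem (insert p m) B → Mem p B ⊎ m ≡ just B
  insert-new p nothing B∈ = inj₁ B∈
  insert-new (a ⇛ s) (just A) B∈ with em {Cons (a ⊕ A) s} | B∈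
  ... | yes _ | inj₁ (inj₁ aB)   = inj₁ (inj₁ aB)
  ... | yes _ | inj₁ (inj₂ refl) = inj₂ refl
  ... | yes _ | inj₂ sB          = inj₁ (inj₂ sB)
  ... | no _  | inj₁ aB          = inj₁ (inj₁ aB)
  ... | no _  | inj₂ (inj₁ sB)   = inj₁ (inj₂ sB)
  ... | no _  | inj₂ (inj₂ refl) = inj₂ refl

  module _ (a₀ s₀ : Pred) where

    stage : ℕ → PreSequent
    stage zero    = a₀ ⇛ s₀
    stage (suc n) = insert (stage n) (target n)

    stage-lhs stage-rhs : ℕ → Pred
    stage-lhs = lhs ∘ stage
    stage-rhs = rhs ∘ stage

    stage-consistent : Cons a₀ s₀ → ∀ n → Cons (stage-lhs n) (stage-rhs n)
    stage-consistent consistent₀ zero    = consistent₀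
    stage-consistent consistent₀ (suc n) =
      insert-consistent (stage n) (target n) (stage-consistent consistent₀ n)

    stage-within : (∀ B → Mem (stage 0) B → L B) → ∀ n B → Mem (stage n) B → L B
    stage-within within₀ zero    = within₀
    stage-within within₀ (suc n) B B∈ with insert-new (stage n) (target n) B∈
    ... | inj₁ B∈earlier = stage-within within₀ n B B∈earlier
    ... | inj₂ B-target  = target-in-L B-target

    stage-decides : ∀ A → L A → Mem (stage (suc (code A))) A
    stage-decides A LA rewrite target-code LA = insert-places (stage (code A)) A

  lindenbaum : ∀ a₀ s₀ → Cons a₀ s₀ → (∀ B → a₀ B ⊎ s₀ B → L B) → Completion L a₀ s₀
  lindenbaum a₀ s₀ consistent₀ within₀ = record
    { ants       = Union (stage-lhs a₀ s₀)
    ; sucs       = Union (stage-rhs a₀ s₀)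
    ; consistent = union-consistent lhs-grows rhs-grows (stage-consistent a₀ s₀ consistent₀)
    ; ants-⊇     = λ aB → 0 , aB
    ; sucs-⊇     = λ sB → 0 , sB
    ; decides    = λ A LA → at-stage (suc (code A)) (stage-decides a₀ s₀ A LA)
    ; within     = λ { B (inj₁ (n , aB)) → stage-within a₀ s₀ within₀ n B (inj₁ aB)
                     ; B (inj₂ (n , sB)) → stage-within a₀ s₀ within₀ n B (inj₂ sB) }
    }
    where
    lhs-grows : Grows (stage-lhs a₀ s₀)
    lhs-grows n = insert-grows-lhs (stage a₀ s₀ n) (target n)
    rhs-grows : Grows (stage-rhs a₀ s₀)
    rhs-grows n = insert-grows-rhs (stage a₀ s₀ n) (target n)
    at-stage : ∀ n {A} → Mem (stage a₀ s₀ n) A → Union (stage-lhs a₀ s₀) A ⊎ Union (stage-rhs a₀ s₀) A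
    at-stage n (inj₁ aA) = inj₁ (n , aA)
    at-stage n (inj₂ sA) = inj₂ (n , sA)

InL-self : ∀ {w B} → ante w B ⊎ succ w B → InL w B
InL-self B∈ s occurs = _ , B∈ , occurs

InL-trans : ∀ {w w₀ A} → (∀ B → ante w B ⊎ succ w B → InL w₀ B) → InL w A → InL w₀ A
InL-trans w⊆L₀ inL s occurs = let B , B∈ , occurs′ = inL s occurs in w⊆L₀ B B∈ s occurs′

InL-fresh : ∀ {w x B} → (∀ B′ → ante w B′ ⊎ succ w B′ → ¬ occF (v x) B′) → InL w B → ¬ occF (v x) B
InL-fresh fresh-in-w inL occurs = let B′ , B′∈ , occurs′ = inL _ occurs in fresh-in-w B′ B′∈ occurs′

mainTheorem6 : ExcludedMiddle 0ℓ → (w₀ : InfSequent) → Consistent w₀ →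
    Σ InfSequent (λ w → MaximalConsistent w × (ante w₀ ⊆ ante w) × (succ w₀ ⊆ succ w))
mainTheorem6 em w₀ consistent₀ =
  w , (consistent , λ A inL → decides A (InL-trans {w = w} {w₀ = w₀} {A = A} within inL)) , ants-⊇ , sucs-⊇
  where
  open Completion (Lindenbaum.lindenbaum em (InL w₀) (ante w₀) (succ w₀) consistent₀ (λ B → InL-self {w = w₀} {B = B}))
  -- the fresh variables of w₀ remain fresh, as w only contains formulas of L_{w₀}
  w : InfSequent
  w = record
    { ante  = ants
    ; succ  = sucs
    ; fresh = λ n → let x , n≤x , fresh₀ = fresh w₀ n
                    in x , n≤x , λ B B∈ → InL-fresh {w = w₀} {B = B} fresh₀ (within B B∈)
    }
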